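{- Let $V=\{v_0,v_1,\dots\}$, $V_0\subset V$, and let $\circledast_I$ be the Grossman–Larson product on $\mathbb Q\langle V\rangle$ associated with the post-Lie algebra $(\mathrm{Lie}(V),[\cdot,\cdot],\triangleright_I)$. Let $A\in\mathbb Q\langle V\rangle$ and $w=w_1v_{i_1}w_2v_{i_2}\cdots w_dv_{i_d}w_{d+1}$ a word with $w_1,\dots,w_{d+1}$ words in the letters of $V_0$ and $v_{i_1},\dots,v_{i_d}\in V\setminus V_0$. Then \[ A\circledast_I w=A_{(1)}\,w_1\,S(A_{(2)})\,v_{i_1}\,A_{(3)}\,w_2\cdots w_d\,S(A_{(2d)})\,v_{i_d}\,A_{(2d+1)}\,w_{d+1}. \]
   Context: $\mathbb Q\langle V\rangle$ is the free associative algebra on $V$ (concatenation), identified with the universal enveloping algebra of the free Lie algebra $\mathrm{Lie}(V)$ (with $[u,w]=uw-wu$); it carries the shuffle coproduct $\Delta$ (multiplicative, letters primitive) with iterated Sweedler notation $\Delta^{[n]}(A)=A_{(1)}\otimes\cdots\otimes A_{(n+1)}$ (summation implicit), and antipode $S(a_1\cdots a_n)=(-1)^na_n\cdots a_1$. For $t\in\mathrm{Lie}(V)$, $t\triangleright_I$ is the derivation of $\mathrm{Lie}(V)$ with $t\triangleright_I v=0$ for $v\in V_0$ and $t\triangleright_I v=[v,t]$ for $v\in V\setminus V_0$; $(\mathrm{Lie}(V),[\cdot,\cdot],\triangleright_I)$ is a post-Lie algebra. The product $\triangleright_I$ is extended to $\mathbb Q\langle V\rangle^{\otimes 2}\to\mathbb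 Q\langle V\rangle$ by $x\triangleright\mathbf1=0$, $\mathbf1\triangleright A=A$, $xA\triangleright y=x\triangleright(A\triangleright y)-(x\triangleright A)\triangleright y$, $A\triangleright BC=(A_{(1)}\triangleright B)(A_{(2)}\triangleright C)$ ($x,y\in\mathrm{Lie}(V)$, $A,B,C\in\mathbb Q\langle V\rangle$), and $A\circledast_I B=A_{(1)}(A_{(2)}\triangleright_I B)$. -}

module Defs where

open import Data.Nat using (ℕ; zero; suc)
import Data.Nat as N
open import Data.Bool using (Bool; true; false; if_then_else_)
open import Data.Rational using (ℚ; 0ℚ; 1ℚ; -_; _+_; _*_)
open import Data.List using (List; []; _∷_; _++_; map; concatMap; foldr; reverse; length)
open import Data.List.Properties using (≡-dec)
open import Data.Vec using (Vec; []; _∷_; fromList)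
open import Data.Product using (_×_; _,_)
open import Relation.Nullary.Decidable using (does)
open import Relation.Binary.PropositionalEquality using (_≡_)

-- Letters: V = {v_0, v_1, ...}, the letter v_i is represented by i : ℕ.
Letter : Set
Letter = ℕ

Word : Set
Word = List Letter

-- Elements of ℚ⟨V⟩ as finite formal linear combinations of words.
Poly : Set
Poly = List (ℚ × Word)

coeff : Poly → Word → ℚ
coeff p u = foldr (λ { (c , w) acc → if does (≡-dec N._≟_ w u) then c + acc else acc }) 0ℚ p

_≈P_ : Poly → Poly → Set
p ≈P q = ∀ u → coeff p u ≡ coeff q u

one : Poly
one = (1ℚ , []) ∷ []

word : Word → Poly
word u = (1ℚ , u) ∷ []

letter : Letter → Poly
letter a = word (a ∷ [])

scale : ℚ → Poly → Poly
scale c = map (λ { (d , u) → (c * d , u) })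

neg : Poly → Poly
neg = scale (- 1ℚ)

_⊕_ : Poly → Poly → Poly
p ⊕ q = p ++ q

_⊖_ : Poly → Poly → Poly
p ⊖ q = p ++ neg q

_·_ : Poly → Poly → Poly
p · q = concatMap (λ { (c , u) → map (λ { (d , w) → (c * d , u ++ w) }) q }) p

linExt : (Word → Poly) → Poly → Poly
linExt f = concatMap (λ { (c , u) → scale c (f u) })

-- Shuffle coproduct of a word (letters primitive, multiplicative):
-- the list of all terms u₍₁₎ ⊗ u₍₂₎, each with coefficient 1.
deshuffle : Word → List (Word × Word)
deshuffle [] = ([] , []) ∷ []
deshuffle (x ∷ xs) =
  concatMap (λ { (l , r) → (x ∷ l , r) ∷ (l , x ∷ r) ∷ [] }) (deshuffle xs)

coprodN : (n : ℕ) → Word → List (Vec Word (suc n))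
coprodN zero u = (u ∷ []) ∷ []
coprodN (suc n) u =
  concatMap (λ { (l , r) → map (l ∷_) (coprodN n r) }) (deshuffle u)

sign : Word → ℚ
sign [] = 1ℚ
sign (_ ∷ xs) = - sign xs

S : Word → Poly
S u = (sign u , reverse u) ∷ []

module PostLie (inV0 : Letter → Bool) where

  derLetter : Poly → Letter → Poly
  derLetter t b = if inV0 b then [] else ((letter b · t) ⊖ (t · letter b))

  -- extension of t ▷_I as a derivation of ℚ⟨V⟩ (= t ▷ A for t primitive)
  derWord : Poly → Word → Poly
  derWord t [] = []
  derWord t (b ∷ bs) = (derLetter t b · word bs) ⊕ (letter b · derWord t bs)

  der : Poly → Poly → Poly
  der t = linExt (derWord t)

  replaceEach : ∀ {n} → (Poly → Poly) → Vec Poly n → List (Vec Poly n)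
  replaceEach f [] = []
  replaceEach f (T ∷ Ts) = (f T ∷ Ts) ∷ map (T ∷_) (replaceEach f Ts)

  -- (T₁ T₂ ⋯ Tₙ) ▷ y for Lie elements Tᵢ and a letter y, via
  --   1 ▷ y = y,   x A ▷ y = x ▷ (A ▷ y) - (x ▷ A) ▷ y,
  -- where x ▷ (T₂⋯Tₙ) = Σⱼ T₂⋯(x ▷ Tⱼ)⋯Tₙ (A ▷ BC rule with x primitive).
  actLie : (n : ℕ) → Vec Poly n → Letter → Poly
  actLie zero [] y = letter y
  actLie (suc n) (t ∷ Ts) y =
    der t (actLie n Ts y)
      ⊖ concatMap (λ Ts' → actLie n Ts' y) (replaceEach (der t) Ts)

  actLetter : Word → Letter → Poly
  actLetter A y = actLie (length A) (Data.Vec.map letter (fromList A)) y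

  act : Word → Word → Poly
  act [] [] = one
  act (_ ∷ _) [] = []
  act A (b ∷ C) =
    concatMap (λ { (A1 , A2) → actLetter A1 b · act A2 C }) (deshuffle A)

  GL : Poly → Poly → Poly
  GL P Q = linExt (λ a → linExt (λ b →
             concatMap (λ { (a1 , a2) → word a1 · act a2 b }) (deshuffle a)) Q) P

-- The word w = w₁ v_{i₁} w₂ ⋯ w_d v_{i_d} w_{d+1}, given by the list of
-- pairs (w_k , i_k), k = 1..d, and the final word w_{d+1}.

wordOf : List (Word × Letter) → Word → Word
wordOf segs last = concatMap (λ { (w , v) → w ++ (v ∷ []) }) segs ++ last

double : ℕ → ℕ
double zero = zero
double (suc n) = suc (suc (double n))

assemble : (segs : List (Word × Letter)) → Word
         → Vec Word (suc (double (length segs))) → Poly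
assemble [] last (a ∷ []) = word (a ++ last)
assemble ((w , v) ∷ segs) last (a1 ∷ a2 ∷ rest) =
  word (a1 ++ w) · (S a2 · (letter v · assemble segs last rest))

rhs : Poly → List (Word × Letter) → Word → Poly
rhs A segs last =
  linExt (λ a → concatMap (assemble segs last)
                          (coprodN (double (length segs)) a)) A

-- For a letter y ∉ V₀ the post-Lie axioms force (T₁⋯Tₙ) ▷ y to be the nested
-- bracket [⋯[[y,T₁],T₂]⋯,Tₙ], and for a word a = a₁⋯aₙ that bracket equals
-- S(a₍₁₎) y a₍₂₎; for y ∈ V₀ it vanishes unless n = 0. Hence, as ▷ distributes
-- over products through the coproduct, a ▷ (w v R) = w S(a₍₁₎) v (a₍₂₎ ⊛ R)
-- for w ∈ V₀*, v ∉ V₀, and the formula follows by induction on the number of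
-- letters outside V₀, reassociating the iterated coproduct by coassociativity.
module Submission where

open import Defs
open import Data.Bool using (Bool; true; false; T; not; if_then_else_)
open import Data.Bool.Properties using (T-≡; T-not-≡)
open import Data.List using (List; []; _∷_; _++_; map; concatMap; reverse; length)
open import Data.List.Relation.Unary.All using (All; []; _∷_)
import Data.List.Properties as List
open import Data.Nat using (zero; suc; _≟_)
open import Data.Product using (_×_; _,_; proj₁; proj₂)
open import Data.Rational using (ℚ; 0ℚ; 1ℚ; -_; _+_; _*_)
import Data.Rational.Properties as ℚ
open import Data.Rational.Solver using (module +-*-Solver)
open import Data.Vec using (Vec; []; _∷_; fromList)
import Data.Vec as Vec
open import Function.Bundles using (Equivalence)
open import Relation.Binary.Bundles using (Setoid)
open import Relation.Binary.PropositionalEquality using (_≡_; refl; sym; trans; cong; cong₂)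
import Relation.Binary.PropositionalEquality as ≡
import Relation.Binary.Reasoning.Setoid as SetoidReasoning
open import Relation.Nullary.Decidable using (does)

open +-*-Solver using (solve; _:+_; _:*_; :-_; _:=_; con)

-- Equality in ℚ⟨V⟩ is tested against all weights f : Word → ℚ, through the
-- pairing ⟨f , Σ cᵢ uᵢ⟩ = Σ cᵢ f(uᵢ); the identities then become identities of
-- rational numbers, independent of how terms are ordered or merged.
pair : (Word → ℚ) → Poly → ℚ
pair f [] = 0ℚ
pair f ((c , u) ∷ p) = c * f u + pair f p

∑ : {X : Set} → (X → ℚ) → List X → ℚ
∑ h [] = 0ℚ
∑ h (x ∷ xs) = h x + ∑ h xs

∑-cong : ∀ {X : Set} {g h : X → ℚ} xs → (∀ x → g x ≡ h x) → ∑ g xs ≡ ∑ h xs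
∑-cong [] e = refl
∑-cong (x ∷ xs) e = cong₂ _+_ (e x) (∑-cong xs e)

∑-+ : ∀ {X : Set} (g h : X → ℚ) xs → ∑ (λ x → g x + h x) xs ≡ ∑ g xs + ∑ h xs
∑-+ g h [] = sym (ℚ.+-identityˡ 0ℚ)
∑-+ g h (x ∷ xs) = trans (cong (g x + h x +_) (∑-+ g h xs))
  (solve 4 (λ a b c d → (a :+ b) :+ (c :+ d) := (a :+ c) :+ (b :+ d)) refl (g x) (h x) (∑ g xs) (∑ h xs))

∑-++ : ∀ {X : Set} (g : X → ℚ) xs ys → ∑ g (xs ++ ys) ≡ ∑ g xs + ∑ g ys
∑-++ g [] ys = sym (ℚ.+-identityˡ _)
∑-++ g (x ∷ xs) ys = trans (cong (g x +_) (∑-++ g xs ys)) (sym (ℚ.+-assoc (g x) (∑ g xs) (∑ g ys)))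

∑-concatMap : ∀ {X Y : Set} (g : Y → ℚ) (h : X → List Y) xs →
              ∑ g (concatMap h xs) ≡ ∑ (λ x → ∑ g (h x)) xs
∑-concatMap g h [] = refl
∑-concatMap g h (x ∷ xs) = trans (∑-++ g (h x) (concatMap h xs)) (cong (∑ g (h x) +_) (∑-concatMap g h xs))

pair-cong : ∀ {f g} p → (∀ u → f u ≡ g u) → pair f p ≡ pair g p
pair-cong [] e = refl
pair-cong ((c , u) ∷ p) e = cong₂ (λ a b → c * a + b) (e u) (pair-cong p e)

pair-++ : ∀ f p q → pair f (p ++ q) ≡ pair f p + pair f q
pair-++ f [] q = sym (ℚ.+-identityˡ _)
pair-++ f ((c , u) ∷ p) q =
  trans (cong (c * f u +_) (pair-++ f p q)) (sym (ℚ.+-assoc (c * f u) (pair f p) (pair f q)))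

pair-+ : ∀ f g p → pair (λ u → f u + g u) p ≡ pair f p + pair g p
pair-+ f g [] = sym (ℚ.+-identityˡ 0ℚ)
pair-+ f g ((c , u) ∷ p) = trans (cong (c * (f u + g u) +_) (pair-+ f g p))
  (solve 5 (λ c a b x y → c :* (a :+ b) :+ (x :+ y) := (c :* a :+ x) :+ (c :* b :+ y))
         refl c (f u) (g u) (pair f p) (pair g p))

pair-* : ∀ k f p → pair (λ u → k * f u) p ≡ k * pair f p
pair-* k f [] = sym (ℚ.*-zeroʳ k)
pair-* k f ((c , u) ∷ p) = trans (cong (c * (k * f u) +_) (pair-* k f p))
  (solve 4 (λ k c a x → c :* (k :* a) :+ k :* x := k :* (c :* a :+ x)) refl k c (f u) (pair f p))

pair-negate : ∀ f p → pair (λ u → - f u) p ≡ - pair f p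
pair-negate f [] = refl
pair-negate f ((c , u) ∷ p) = trans (cong (c * (- f u) +_) (pair-negate f p))
  (solve 3 (λ c a x → c :* (:- a) :+ :- x := :- (c :* a :+ x)) refl c (f u) (pair f p))

pair-zero : ∀ p → pair (λ _ → 0ℚ) p ≡ 0ℚ
pair-zero [] = refl
pair-zero ((c , u) ∷ p) =
  trans (cong (c * 0ℚ +_) (pair-zero p)) (solve 1 (λ c → c :* con 0ℚ :+ con 0ℚ := con 0ℚ) refl c)

pair-scale : ∀ f c p → pair f (scale c p) ≡ c * pair f p
pair-scale f c [] = sym (ℚ.*-zeroʳ c)
pair-scale f c ((d , u) ∷ p) = trans (cong ((c * d) * f u +_) (pair-scale f c p))
  (solve 4 (λ c d a x → c :* d :* a :+ c :* x := c :* (d :* a :+ x)) refl c d (f u) (pair f p))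

pair-neg : ∀ f p → pair f (neg p) ≡ - pair f p
pair-neg f p = trans (pair-scale f (- 1ℚ) p) (solve 1 (λ x → (:- con 1ℚ) :* x := :- x) refl (pair f p))

pair-word : ∀ f u → pair f (word u) ≡ f u
pair-word f u = solve 1 (λ a → con 1ℚ :* a :+ con 0ℚ := a) refl (f u)

pair-· : ∀ f p q → pair f (p · q) ≡ pair (λ u → pair (λ w → f (u ++ w)) q) p
pair-· f [] q = refl
pair-· f ((c , u) ∷ p) q = trans (pair-++ f (map _ q) (p · q)) (cong₂ _+_ (pair-left-mul q) (pair-· f p q))
  where
  pair-left-mul : ∀ q → pair f (map (λ { (d , w) → (c * d , u ++ w) }) q) ≡ c * pair (λ w → f (u ++ w)) q
  pair-left-mul [] = sym (ℚ.*-zeroʳ c)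
  pair-left-mul ((d , w) ∷ q) = trans (cong ((c * d) * f (u ++ w) +_) (pair-left-mul q))
    (solve 4 (λ c d a x → c :* d :* a :+ c :* x := c :* (d :* a :+ x))
           refl c d (f (u ++ w)) (pair (λ w → f (u ++ w)) q))

pair-linExt : ∀ f g p → pair f (linExt g p) ≡ pair (λ u → pair f (g u)) p
pair-linExt f g [] = refl
pair-linExt f g ((c , u) ∷ p) =
  trans (pair-++ f (scale c (g u)) (linExt g p)) (cong₂ _+_ (pair-scale f c (g u)) (pair-linExt f g p))

pair-concatMap : ∀ {X : Set} f (g : X → Poly) xs → pair f (concatMap g xs) ≡ ∑ (λ x → pair f (g x)) xs
pair-concatMap f g [] = refl
pair-concatMap f g (x ∷ xs) =
  trans (pair-++ f (g x) (concatMap g xs)) (cong (pair f (g x) +_) (pair-concatMap f g xs))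

pair-swap : ∀ (k : Word → Word → ℚ) p q →
            pair (λ a → pair (k a) q) p ≡ pair (λ w → pair (λ a → k a w) p) q
pair-swap k [] q = sym (pair-zero q)
pair-swap k ((c , u) ∷ p) q = trans (cong (c * pair (k u) q +_) (pair-swap k p q)) (sym (begin
    pair (λ w → c * k u w + pair (λ a → k a w) p) q
  ≡⟨ pair-+ (λ w → c * k u w) (λ w → pair (λ a → k a w) p) q ⟩
    pair (λ w → c * k u w) q + pair (λ w → pair (λ a → k a w) p) q
  ≡⟨ cong (_+ pair (λ w → pair (λ a → k a w) p) q) (pair-* c (k u) q) ⟩
    c * pair (k u) q + pair (λ w → pair (λ a → k a w) p) q
  ∎))
  where open ≡.≡-Reasoning

pair-∑ : ∀ {X : Set} (k : Word → X → ℚ) p xs → pair (λ u → ∑ (k u) xs) p ≡ ∑ (λ x → pair (λ u → k u x) p) xs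
pair-∑ k p [] = pair-zero p
pair-∑ k p (x ∷ xs) =
  trans (pair-+ (λ u → k u x) (λ u → ∑ (k u) xs) p) (cong (pair (λ u → k u x) p +_) (pair-∑ k p xs))

infix 4 _≈_
record _≈_ (p q : Poly) : Set where
  constructor mk
  field run : ∀ f → pair f p ≡ pair f q
open _≈_

≈-refl : ∀ {p} → p ≈ p
≈-refl = mk λ f → refl

≈-sym : ∀ {p q} → p ≈ q → q ≈ p
≈-sym e = mk λ f → sym (run e f)

≈-trans : ∀ {p q r} → p ≈ q → q ≈ r → p ≈ r
≈-trans e e′ = mk λ f → trans (run e f) (run e′ f)

≡⇒≈ : ∀ {p q} → p ≡ q → p ≈ q
≡⇒≈ refl = ≈-refl

≈-setoid : Setoid _ _
≈-setoid = record
  { Carrier = Poly ; _≈_ = _≈_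
  ; isEquivalence = record { refl = ≈-refl ; sym = ≈-sym ; trans = ≈-trans } }

module ≈-Reasoning = SetoidReasoning ≈-setoid

indicator : Word → Word → ℚ
indicator u w = if does (List.≡-dec _≟_ w u) then 1ℚ else 0ℚ

coeff-pair : ∀ p u → coeff p u ≡ pair (indicator u) p
coeff-pair [] u = refl
coeff-pair ((c , w) ∷ p) u with does (List.≡-dec _≟_ w u)
... | true  = trans (cong (c +_) (coeff-pair p u)) (cong (_+ pair (indicator u) p) (sym (ℚ.*-identityʳ c)))
... | false = trans (coeff-pair p u) (sym (trans (cong (_+ pair (indicator u) p) (ℚ.*-zeroʳ c)) (ℚ.+-identityˡ _)))

≈⇒≈P : ∀ {p q} → p ≈ q → p ≈P q
≈⇒≈P {p} {q} e u = trans (coeff-pair p u) (trans (run e (indicator u)) (sym (coeff-pair q u)))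

⊕-cong : ∀ {p p′ q q′} → p ≈ p′ → q ≈ q′ → p ⊕ q ≈ p′ ⊕ q′
⊕-cong {p} {p′} {q} {q′} e e′ = mk λ f →
  trans (pair-++ f p q) (trans (cong₂ _+_ (run e f) (run e′ f)) (sym (pair-++ f p′ q′)))

neg-cong : ∀ {p q} → p ≈ q → neg p ≈ neg q
neg-cong {p} {q} e = mk λ f → trans (pair-neg f p) (trans (cong -_ (run e f)) (sym (pair-neg f q)))

⊖-cong : ∀ {p p′ q q′} → p ≈ p′ → q ≈ q′ → p ⊖ q ≈ p′ ⊖ q′
⊖-cong e e′ = ⊕-cong e (neg-cong e′)

·-congˡ : ∀ {p p′} q → p ≈ p′ → p · q ≈ p′ · q
·-congˡ {p} {p′} q e = mk λ f →
  trans (pair-· f p q) (trans (run e (λ u → pair (λ w → f (u ++ w)) q)) (sym (pair-· f p′ q)))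

·-congʳ : ∀ p {q q′} → q ≈ q′ → p · q ≈ p · q′
·-congʳ p {q} {q′} e = mk λ f →
  trans (pair-· f p q) (trans (pair-cong p (λ u → run e (λ w → f (u ++ w)))) (sym (pair-· f p q′)))

·-cong : ∀ {p p′ q q′} → p ≈ p′ → q ≈ q′ → p · q ≈ p′ · q′
·-cong {p′ = p′} {q = q} e e′ = ≈-trans (·-congˡ q e) (·-congʳ p′ e′)

linExt-cong : ∀ {g h} p → (∀ u → g u ≈ h u) → linExt g p ≈ linExt h p
linExt-cong {g} {h} p e = mk λ f →
  trans (pair-linExt f g p) (trans (pair-cong p (λ u → run (e u) f)) (sym (pair-linExt f h p)))

linExt-congʳ : ∀ g {p q} → p ≈ q → linExt g p ≈ linExt g q
linExt-congʳ g {p} {q} e = mk λ f →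
  trans (pair-linExt f g p) (trans (run e (λ u → pair f (g u))) (sym (pair-linExt f g q)))

linExt-word : ∀ g u → linExt g (word u) ≈ g u
linExt-word g u = mk λ f → trans (pair-linExt f g (word u)) (pair-word (λ v → pair f (g v)) u)

concatMap-cong : ∀ {X : Set} {g h : X → Poly} xs → (∀ x → g x ≈ h x) → concatMap g xs ≈ concatMap h xs
concatMap-cong {g = g} {h} xs e = mk λ f →
  trans (pair-concatMap f g xs) (trans (∑-cong xs (λ x → run (e x) f)) (sym (pair-concatMap f h xs)))

concatMap-concatMap : ∀ {X Y : Set} (g : Y → Poly) (h : X → List Y) xs →
                      concatMap g (concatMap h xs) ≈ concatMap (λ x → concatMap g (h x)) xs
concatMap-concatMap g h xs = mk λ f →
  trans (pair-concatMap f g (concatMap h xs)) (trans (∑-concatMap (λ y → pair f (g y)) h xs)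
  (trans (∑-cong xs (λ x → sym (pair-concatMap f g (h x)))) (sym (pair-concatMap f (λ x → concatMap g (h x)) xs))))

concatMap-map : ∀ {X Y : Set} (g : Y → Poly) (h : X → Y) xs → concatMap g (map h xs) ≈ concatMap (λ x → g (h x)) xs
concatMap-map g h xs = ≡⇒≈ (List.concatMap-map g h xs)

⊕-comm : ∀ p q → p ⊕ q ≈ q ⊕ p
⊕-comm p q = mk λ f → trans (pair-++ f p q) (trans (ℚ.+-comm (pair f p) (pair f q)) (sym (pair-++ f q p)))

⊕-assoc : ∀ p q r → (p ⊕ q) ⊕ r ≈ p ⊕ (q ⊕ r)
⊕-assoc p q r = ≡⇒≈ (List.++-assoc p q r)

⊕-identityʳ : ∀ p → p ⊕ [] ≈ p
⊕-identityʳ p = ≡⇒≈ (List.++-identityʳ p)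

⊕-interchange : ∀ x y z w → (x ⊕ y) ⊕ (z ⊕ w) ≈ (x ⊕ z) ⊕ (y ⊕ w)
⊕-interchange x y z w = mk λ f → begin
    pair f ((x ⊕ y) ⊕ (z ⊕ w))
  ≡⟨ trans (pair-++ f (x ++ y) (z ++ w)) (cong₂ _+_ (pair-++ f x y) (pair-++ f z w)) ⟩
    (pair f x + pair f y) + (pair f z + pair f w)
  ≡⟨ solve 4 (λ a b c d → (a :+ b) :+ (c :+ d) := (a :+ c) :+ (b :+ d)) refl (pair f x) (pair f y) (pair f z) (pair f w) ⟩
    (pair f x + pair f z) + (pair f y + pair f w)
  ≡⟨ sym (trans (pair-++ f (x ++ z) (y ++ w)) (cong₂ _+_ (pair-++ f x z) (pair-++ f y w))) ⟩
    pair f ((x ⊕ z) ⊕ (y ⊕ w))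
  ∎
  where open ≡.≡-Reasoning

⊕-⊖-cancel : ∀ p q → (p ⊕ q) ⊖ q ≈ p
⊕-⊖-cancel p q = mk λ f → begin
    pair f ((p ⊕ q) ⊖ q)
  ≡⟨ trans (pair-++ f (p ++ q) (neg q)) (cong₂ _+_ (pair-++ f p q) (pair-neg f q)) ⟩
    (pair f p + pair f q) + - pair f q
  ≡⟨ solve 2 (λ a b → (a :+ b) :+ :- b := a) refl (pair f p) (pair f q) ⟩
    pair f p
  ∎
  where open ≡.≡-Reasoning

neg-⊕ : ∀ p q → neg (p ⊕ q) ≈ neg p ⊕ neg q
neg-⊕ p q = ≡⇒≈ (List.map-++ _ p q)

·-assoc : ∀ p q r → (p · q) · r ≈ p · (q · r)
·-assoc p q r = mk λ f → begin
    pair f ((p · q) · r)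
  ≡⟨ trans (pair-· f (p · q) r) (pair-· (λ a → pair (λ w → f (a ++ w)) r) p q) ⟩
    pair (λ u → pair (λ v → pair (λ w → f ((u ++ v) ++ w)) r) q) p
  ≡⟨ pair-cong p (λ u → pair-cong q (λ v → pair-cong r (λ w → cong f (List.++-assoc u v w)))) ⟩
    pair (λ u → pair (λ v → pair (λ w → f (u ++ (v ++ w))) r) q) p
  ≡⟨ sym (trans (pair-· f p (q · r)) (pair-cong p (λ u → pair-· (λ b → f (u ++ b)) q r))) ⟩
    pair f (p · (q · r))
  ∎
  where open ≡.≡-Reasoning

·-distribˡ : ∀ p q r → p · (q ⊕ r) ≈ (p · q) ⊕ (p · r)
·-distribˡ p q r = mk λ f → begin
    pair f (p · (q ⊕ r))
  ≡⟨ trans (pair-· f p (q ++ r)) (pair-cong p (λ u → pair-++ (λ w → f (u ++ w)) q r)) ⟩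
    pair (λ u → pair (λ w → f (u ++ w)) q + pair (λ w → f (u ++ w)) r) p
  ≡⟨ pair-+ (λ u → pair (λ w → f (u ++ w)) q) (λ u → pair (λ w → f (u ++ w)) r) p ⟩
    pair (λ u → pair (λ w → f (u ++ w)) q) p + pair (λ u → pair (λ w → f (u ++ w)) r) p
  ≡⟨ sym (trans (pair-++ f (p · q) (p · r)) (cong₂ _+_ (pair-· f p q) (pair-· f p r))) ⟩
    pair f ((p · q) ⊕ (p · r))
  ∎
  where open ≡.≡-Reasoning

·-distribʳ : ∀ p q r → (p ⊕ q) · r ≈ (p · r) ⊕ (q · r)
·-distribʳ p q r = mk λ f →
  trans (pair-· f (p ++ q) r) (trans (pair-++ (λ u → pair (λ w → f (u ++ w)) r) p q)
  (sym (trans (pair-++ f (p · r) (q · r)) (cong₂ _+_ (pair-· f p r) (pair-· f q r)))))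

neg-·ˡ : ∀ p q → neg p · q ≈ neg (p · q)
neg-·ˡ p q = mk λ f → trans (pair-· f (neg p) q)
  (trans (pair-neg (λ u → pair (λ w → f (u ++ w)) q) p) (sym (trans (pair-neg f (p · q)) (cong -_ (pair-· f p q)))))

neg-·ʳ : ∀ p q → p · neg q ≈ neg (p · q)
neg-·ʳ p q = mk λ f →
  trans (pair-· f p (neg q)) (trans (pair-cong p (λ u → pair-neg (λ w → f (u ++ w)) q))
  (trans (pair-negate (λ u → pair (λ w → f (u ++ w)) q) p) (sym (trans (pair-neg f (p · q)) (cong -_ (pair-· f p q))))))

·-distribˡ-⊖ : ∀ p q r → p · (q ⊖ r) ≈ (p · q) ⊖ (p · r)
·-distribˡ-⊖ p q r = ≈-trans (·-distribˡ p q (neg r)) (⊕-cong ≈-refl (neg-·ʳ p r))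

·-distribʳ-⊖ : ∀ p q r → (p ⊖ q) · r ≈ (p · r) ⊖ (q · r)
·-distribʳ-⊖ p q r = ≈-trans (·-distribʳ p (neg q) r) (⊕-cong ≈-refl (neg-·ˡ q r))

·-identityˡ : ∀ p → word [] · p ≈ p
·-identityˡ p = mk λ f → trans (pair-· f (word []) p) (pair-word (λ a → pair (λ b → f (a ++ b)) p) [])

·-identityʳ : ∀ p → p · word [] ≈ p
·-identityʳ p = mk λ f → trans (pair-· f p (word []))
  (pair-cong p (λ u → trans (pair-word (λ b → f (u ++ b)) []) (cong f (List.++-identityʳ u))))

·-zeroʳ : ∀ p → p · [] ≈ []
·-zeroʳ p = mk λ f → trans (pair-· f p []) (pair-zero p)

word-· : ∀ u w → word u · word w ≈ word (u ++ w)
word-· u w = mk λ f → trans (pair-· f (word u) (word w))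
  (trans (pair-word (λ a → pair (λ b → f (a ++ b)) (word w)) u)
  (trans (pair-word (λ b → f (u ++ b)) w) (sym (pair-word f (u ++ w)))))

concatMap-·ˡ : ∀ {X : Set} p (g : X → Poly) xs → p · concatMap g xs ≈ concatMap (λ x → p · g x) xs
concatMap-·ˡ p g xs = mk λ f → begin
    pair f (p · concatMap g xs)
  ≡⟨ trans (pair-· f p (concatMap g xs)) (pair-cong p (λ u → pair-concatMap (λ w → f (u ++ w)) g xs)) ⟩
    pair (λ u → ∑ (λ x → pair (λ w → f (u ++ w)) (g x)) xs) p
  ≡⟨ pair-∑ (λ u x → pair (λ w → f (u ++ w)) (g x)) p xs ⟩
    ∑ (λ x → pair (λ u → pair (λ w → f (u ++ w)) (g x)) p) xs
  ≡⟨ sym (trans (pair-concatMap f (λ x → p · g x) xs) (∑-cong xs (λ x → pair-· f p (g x)))) ⟩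
    pair f (concatMap (λ x → p · g x) xs)
  ∎
  where open ≡.≡-Reasoning

concatMap-·ʳ : ∀ {X : Set} (g : X → Poly) xs q → concatMap g xs · q ≈ concatMap (λ x → g x · q) xs
concatMap-·ʳ g xs q = mk λ f →
  trans (pair-· f (concatMap g xs) q) (trans (pair-concatMap (λ u → pair (λ w → f (u ++ w)) q) g xs)
  (sym (trans (pair-concatMap f (λ x → g x · q) xs) (∑-cong xs (λ x → pair-· f (g x) q)))))

⟦_,_⟧ : Poly → Poly → Poly
⟦ p , q ⟧ = (p · q) ⊖ (q · p)

⟦⟧-congˡ : ∀ {p p′} q → p ≈ p′ → ⟦ p , q ⟧ ≈ ⟦ p′ , q ⟧
⟦⟧-congˡ q e = ⊖-cong (·-congˡ q e) (·-congʳ q e)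

⟦⟧-⊕ˡ : ∀ p q r → ⟦ p ⊕ q , r ⟧ ≈ ⟦ p , r ⟧ ⊕ ⟦ q , r ⟧
⟦⟧-⊕ˡ p q r = begin
    ((p ⊕ q) · r) ⊖ (r · (p ⊕ q))
  ≈⟨ ⊖-cong (·-distribʳ p q r) (·-distribˡ r p q) ⟩
    ((p · r) ⊕ (q · r)) ⊕ neg ((r · p) ⊕ (r · q))
  ≈⟨ ⊕-cong ≈-refl (neg-⊕ (r · p) (r · q)) ⟩
    ((p · r) ⊕ (q · r)) ⊕ (neg (r · p) ⊕ neg (r · q))
  ≈⟨ ⊕-interchange (p · r) (q · r) (neg (r · p)) (neg (r · q)) ⟩
    ⟦ p , r ⟧ ⊕ ⟦ q , r ⟧
  ∎
  where open ≈-Reasoning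

nestedBracket : ∀ {n} → Vec Poly n → Poly → Poly
nestedBracket [] m = m
nestedBracket (T ∷ Ts) m = nestedBracket Ts ⟦ m , T ⟧

nestedBracket-cong : ∀ {n} (Ts : Vec Poly n) {m m′} → m ≈ m′ → nestedBracket Ts m ≈ nestedBracket Ts m′
nestedBracket-cong [] e = e
nestedBracket-cong (T ∷ Ts) e = nestedBracket-cong Ts (⟦⟧-congˡ T e)

nestedBracket-⊕ : ∀ {n} (Ts : Vec Poly n) p q → nestedBracket Ts (p ⊕ q) ≈ nestedBracket Ts p ⊕ nestedBracket Ts q
nestedBracket-⊕ [] p q = ≈-refl
nestedBracket-⊕ (T ∷ Ts) p q =
  ≈-trans (nestedBracket-cong Ts (⟦⟧-⊕ˡ p q T)) (nestedBracket-⊕ Ts ⟦ p , T ⟧ ⟦ q , T ⟧)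

conjugate : Poly → Word × Word → Poly
conjugate m (l , r) = (S l · m) · word r

S-∷ : ∀ x l → S (x ∷ l) ≈ neg (S l · letter x)
S-∷ x l = mk λ f → begin
    - sign l * f (reverse (x ∷ l)) + 0ℚ
  ≡⟨ cong (λ v → - sign l * f v + 0ℚ) (List.unfold-reverse x l) ⟩
    - sign l * f v + 0ℚ
  ≡⟨ solve 2 (λ s a → :- s :* a :+ con 0ℚ := :- ((s :* con 1ℚ) :* a :+ con 0ℚ)) refl (sign l) (f v) ⟩
    - ((sign l * 1ℚ) * f v + 0ℚ)
  ≡⟨ sym (pair-neg f (S l · letter x)) ⟩
    pair f (neg (S l · letter x))
  ∎
  where
  open ≡.≡-Reasoning
  v = reverse l ++ x ∷ []

conjugate-⟦⟧ : ∀ m x l r → conjugate ⟦ m , letter x ⟧ (l , r) ≈ conjugate m (x ∷ l , r) ⊕ conjugate m (l , x ∷ r)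
conjugate-⟦⟧ m x l r = begin
    (S l · ⟦ m , X ⟧) · word r
  ≈⟨ ·-congˡ (word r) (·-distribˡ-⊖ (S l) (m · X) (X · m)) ⟩
    ((S l · (m · X)) ⊖ (S l · (X · m))) · word r
  ≈⟨ ·-distribʳ-⊖ (S l · (m · X)) (S l · (X · m)) (word r) ⟩
    ((S l · (m · X)) · word r) ⊖ ((S l · (X · m)) · word r)
  ≈⟨ ⊕-comm ((S l · (m · X)) · word r) (neg ((S l · (X · m)) · word r)) ⟩
    neg ((S l · (X · m)) · word r) ⊕ ((S l · (m · X)) · word r)
  ≈⟨ ⊕-cong letter-moves-left letter-moves-right ⟩
    conjugate m (x ∷ l , r) ⊕ conjugate m (l , x ∷ r)
  ∎
  where
  open ≈-Reasoning
  X = letter x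
  letter-moves-left : neg ((S l · (X · m)) · word r) ≈ (S (x ∷ l) · m) · word r
  letter-moves-left = begin
      neg ((S l · (X · m)) · word r)
    ≈⟨ neg-cong (·-congˡ (word r) (≈-sym (·-assoc (S l) X m))) ⟩
      neg (((S l · X) · m) · word r)
    ≈⟨ ≈-sym (neg-·ˡ ((S l · X) · m) (word r)) ⟩
      neg ((S l · X) · m) · word r
    ≈⟨ ·-congˡ (word r) (≈-sym (neg-·ˡ (S l · X) m)) ⟩
      (neg (S l · X) · m) · word r
    ≈⟨ ·-congˡ (word r) (·-congˡ m (≈-sym (S-∷ x l))) ⟩
      (S (x ∷ l) · m) · word r
    ∎
  letter-moves-right : (S l · (m · X)) · word r ≈ (S l · m) · word (x ∷ r)
  letter-moves-right = begin
      (S l · (m · X)) · word r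
    ≈⟨ ·-congˡ (word r) (≈-sym (·-assoc (S l) m X)) ⟩
      ((S l · m) · X) · word r
    ≈⟨ ·-assoc (S l · m) X (word r) ⟩
      (S l · m) · (X · word r)
    ≈⟨ ·-congʳ (S l · m) (word-· (x ∷ []) r) ⟩
      (S l · m) · word (x ∷ r)
    ∎

nestedBracket-letters : ∀ a m → nestedBracket (Vec.map letter (fromList a)) m ≈ concatMap (conjugate m) (deshuffle a)
nestedBracket-letters [] m =
  ≈-sym (≈-trans (⊕-identityʳ _) (≈-trans (·-identityʳ (S [] · m)) (·-identityˡ m)))
nestedBracket-letters (x ∷ a) m = begin
    nestedBracket (Vec.map letter (fromList a)) ⟦ m , letter x ⟧
  ≈⟨ nestedBracket-letters a ⟦ m , letter x ⟧ ⟩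
    concatMap (conjugate ⟦ m , letter x ⟧) (deshuffle a)
  ≈⟨ concatMap-cong (deshuffle a) (λ lr →
       ≈-trans (conjugate-⟦⟧ m x (proj₁ lr) (proj₂ lr))
               (⊕-cong ≈-refl (≈-sym (⊕-identityʳ (conjugate m (proj₁ lr , x ∷ proj₂ lr)))))) ⟩
    concatMap (λ lr → conjugate m (x ∷ proj₁ lr , proj₂ lr) ⊕ (conjugate m (proj₁ lr , x ∷ proj₂ lr) ⊕ [])) (deshuffle a)
  ≈⟨ ≈-sym (concatMap-concatMap (conjugate m) _ (deshuffle a)) ⟩
    concatMap (conjugate m) (deshuffle (x ∷ a))
  ∎
  where open ≈-Reasoning

infixr 30 ε[_]_
ε[_]_ : Word → Poly → Poly
ε[ [] ] p = p
ε[ _ ∷ _ ] p = []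

counitˡ : ∀ (h : Word → Poly) a → concatMap (λ lr → ε[ proj₁ lr ] h (proj₂ lr)) (deshuffle a) ≈ h a
counitˡ h [] = ⊕-identityʳ (h [])
counitˡ h (x ∷ a) = ≈-trans (concatMap-concatMap (λ lr → ε[ proj₁ lr ] h (proj₂ lr)) _ (deshuffle a))
  (≈-trans (concatMap-cong (deshuffle a) (λ lr → ⊕-identityʳ (ε[ proj₁ lr ] h (x ∷ proj₂ lr))))
           (counitˡ (λ r → h (x ∷ r)) a))

counitʳ : ∀ (h : Word → Poly) a → concatMap (λ lr → ε[ proj₂ lr ] h (proj₁ lr)) (deshuffle a) ≈ h a
counitʳ h [] = ⊕-identityʳ (h [])
counitʳ h (x ∷ a) = ≈-trans (concatMap-concatMap (λ lr → ε[ proj₂ lr ] h (proj₁ lr)) _ (deshuffle a))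
  (≈-trans (concatMap-cong (deshuffle a) (λ lr → ⊕-identityʳ (ε[ proj₂ lr ] h (x ∷ proj₁ lr))))
           (counitʳ (λ l → h (x ∷ l)) a))

∑-deshuffle-∷ : ∀ (h : Word × Word → ℚ) x a →
  ∑ h (deshuffle (x ∷ a)) ≡ ∑ (λ lr → h (x ∷ proj₁ lr , proj₂ lr) + h (proj₁ lr , x ∷ proj₂ lr)) (deshuffle a)
∑-deshuffle-∷ h x a = trans (∑-concatMap h _ (deshuffle a))
  (∑-cong (deshuffle a) (λ lr → cong (h (x ∷ proj₁ lr , proj₂ lr) +_) (ℚ.+-identityʳ _)))

∑[Δ⊗id]Δ ∑[id⊗Δ]Δ : (Word → Word → Word → ℚ) → Word → ℚ
∑[Δ⊗id]Δ k a =
  ∑ (λ lr → ∑ (λ lr′ → k (proj₁ lr′) (proj₂ lr′) (proj₂ lr)) (deshuffle (proj₁ lr))) (deshuffle a)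
∑[id⊗Δ]Δ k a =
  ∑ (λ lr → ∑ (λ lr′ → k (proj₁ lr) (proj₁ lr′) (proj₂ lr′)) (deshuffle (proj₂ lr))) (deshuffle a)

-- A new first letter x of a lands in exactly one of the three tensor factors,
-- on either side.
∑-coassoc : ∀ k a → ∑[Δ⊗id]Δ k a ≡ ∑[id⊗Δ]Δ k a
∑-coassoc k [] = refl
∑-coassoc k (x ∷ a) = begin
    ∑[Δ⊗id]Δ k (x ∷ a)
  ≡⟨ split-Δ⊗id ⟩
    (∑[Δ⊗id]Δ k₁ a + ∑[Δ⊗id]Δ k₂ a) + ∑[Δ⊗id]Δ k₃ a
  ≡⟨ cong₂ _+_ (cong₂ _+_ (∑-coassoc k₁ a) (∑-coassoc k₂ a)) (∑-coassoc k₃ a) ⟩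
    (∑[id⊗Δ]Δ k₁ a + ∑[id⊗Δ]Δ k₂ a) + ∑[id⊗Δ]Δ k₃ a
  ≡⟨ ℚ.+-assoc (∑[id⊗Δ]Δ k₁ a) (∑[id⊗Δ]Δ k₂ a) (∑[id⊗Δ]Δ k₃ a) ⟩
    ∑[id⊗Δ]Δ k₁ a + (∑[id⊗Δ]Δ k₂ a + ∑[id⊗Δ]Δ k₃ a)
  ≡⟨ sym split-id⊗Δ ⟩
    ∑[id⊗Δ]Δ k (x ∷ a)
  ∎
  where
  open ≡.≡-Reasoning
  k₁ k₂ k₃ : Word → Word → Word → ℚ
  k₁ p q r = k (x ∷ p) q r
  k₂ p q r = k p (x ∷ q) r
  k₃ p q r = k p q (x ∷ r)
  inner-Δ⊗id inner-id⊗Δ : (Word → Word → Word → ℚ) → Word × Word → ℚ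
  inner-Δ⊗id k′ lr = ∑ (λ lr′ → k′ (proj₁ lr′) (proj₂ lr′) (proj₂ lr)) (deshuffle (proj₁ lr))
  inner-id⊗Δ k′ lr = ∑ (λ lr′ → k′ (proj₁ lr) (proj₁ lr′) (proj₂ lr′)) (deshuffle (proj₂ lr))
  split-Δ⊗id : ∑[Δ⊗id]Δ k (x ∷ a) ≡ (∑[Δ⊗id]Δ k₁ a + ∑[Δ⊗id]Δ k₂ a) + ∑[Δ⊗id]Δ k₃ a
  split-Δ⊗id = trans (∑-deshuffle-∷ (inner-Δ⊗id k) x a)
    (trans (∑-cong (deshuffle a) (λ lr → cong (_+ inner-Δ⊗id k₃ lr)
              (trans (∑-deshuffle-∷ _ x (proj₁ lr)) (∑-+ _ _ (deshuffle (proj₁ lr))))))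
    (trans (∑-+ _ (inner-Δ⊗id k₃) (deshuffle a))
           (cong (_+ ∑[Δ⊗id]Δ k₃ a) (∑-+ (inner-Δ⊗id k₁) (inner-Δ⊗id k₂) (deshuffle a)))))
  split-id⊗Δ : ∑[id⊗Δ]Δ k (x ∷ a) ≡ ∑[id⊗Δ]Δ k₁ a + (∑[id⊗Δ]Δ k₂ a + ∑[id⊗Δ]Δ k₃ a)
  split-id⊗Δ = trans (∑-deshuffle-∷ (inner-id⊗Δ k) x a)
    (trans (∑-cong (deshuffle a) (λ lr → cong (inner-id⊗Δ k₁ lr +_)
              (trans (∑-deshuffle-∷ _ x (proj₂ lr)) (∑-+ _ _ (deshuffle (proj₂ lr))))))
    (trans (∑-+ (inner-id⊗Δ k₁) _ (deshuffle a))
           (cong (∑[id⊗Δ]Δ k₁ a +_) (∑-+ (inner-id⊗Δ k₂) (inner-id⊗Δ k₃) (deshuffle a)))))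

deshuffle-coassoc : ∀ (g : Word → Word → Word → Poly) a →
  concatMap (λ lr → concatMap (λ lr′ → g (proj₁ lr′) (proj₂ lr′) (proj₂ lr)) (deshuffle (proj₁ lr))) (deshuffle a)
  ≈ concatMap (λ lr → concatMap (λ lr′ → g (proj₁ lr) (proj₁ lr′) (proj₂ lr′)) (deshuffle (proj₂ lr))) (deshuffle a)
deshuffle-coassoc g a = mk λ f →
  trans (pair-concatMap f _ (deshuffle a)) (trans (∑-cong (deshuffle a) (λ lr → pair-concatMap f _ (deshuffle (proj₁ lr))))
  (trans (∑-coassoc (λ p q r → pair f (g p q r)) a)
  (sym (trans (pair-concatMap f _ (deshuffle a)) (∑-cong (deshuffle a) (λ lr → pair-concatMap f _ (deshuffle (proj₂ lr))))))))

spliceAt : Word → Letter → (Word → Poly) → Word → Poly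
spliceAt w v F a = concatMap (λ lr → word (proj₁ lr ++ w) ·
  concatMap (λ lr′ → (S (proj₁ lr′) · letter v) · F (proj₂ lr′)) (deshuffle (proj₂ lr))) (deshuffle a)

spliceAt-cong : ∀ w v {F G} → (∀ m → F m ≈ G m) → ∀ a → spliceAt w v F a ≈ spliceAt w v G a
spliceAt-cong w v e a = concatMap-cong (deshuffle a) (λ lr → ·-congʳ (word (proj₁ lr ++ w))
  (concatMap-cong (deshuffle (proj₂ lr)) (λ lr′ → ·-congʳ (S (proj₁ lr′) · letter v) (e (proj₂ lr′)))))

assemble-coprodN-∷ : ∀ w v segs last a →
  concatMap (assemble ((w , v) ∷ segs) last) (coprodN (double (length ((w , v) ∷ segs))) a)
  ≈ spliceAt w v (λ m → concatMap (assemble segs last) (coprodN (double (length segs)) m)) a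
assemble-coprodN-∷ w v segs last a =
  ≈-trans (concatMap-concatMap asm _ (deshuffle a)) (concatMap-cong (deshuffle a) (λ lr →
  ≈-trans (concatMap-map asm (proj₁ lr ∷_) (coprodN (suc n) (proj₂ lr)))
  (≈-trans (concatMap-concatMap (λ t → asm (proj₁ lr ∷ t)) _ (deshuffle (proj₂ lr)))
  (≈-trans (concatMap-cong (deshuffle (proj₂ lr)) (λ lr′ →
     ≈-trans (concatMap-map (λ t → asm (proj₁ lr ∷ t)) (proj₁ lr′ ∷_) (coprodN n (proj₂ lr′)))
             (factor-out (word (proj₁ lr ++ w)) (S (proj₁ lr′)) (coprodN n (proj₂ lr′)))))
  (≈-sym (concatMap-·ˡ (word (proj₁ lr ++ w)) _ (deshuffle (proj₂ lr))))))))
  where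
  n = double (length segs)
  asm = assemble ((w , v) ∷ segs) last
  factor-out : ∀ p q ts → concatMap (λ t → p · (q · (letter v · assemble segs last t))) ts
                          ≈ p · ((q · letter v) · concatMap (assemble segs last) ts)
  factor-out p q ts = begin
      concatMap (λ t → p · (q · (letter v · assemble segs last t))) ts
    ≈⟨ concatMap-cong ts (λ t → ·-congʳ p (≈-sym (·-assoc q (letter v) (assemble segs last t)))) ⟩
      concatMap (λ t → p · ((q · letter v) · assemble segs last t)) ts
    ≈⟨ ≈-sym (concatMap-·ˡ p _ ts) ⟩
      p · concatMap (λ t → (q · letter v) · assemble segs last t) ts
    ≈⟨ ·-congʳ p (≈-sym (concatMap-·ˡ (q · letter v) (assemble segs last) ts)) ⟩
      p · ((q · letter v) · concatMap (assemble segs last) ts)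
    ∎
    where open ≈-Reasoning

wordOf-∷ : ∀ w v segs last → wordOf ((w , v) ∷ segs) last ≡ w ++ v ∷ wordOf segs last
wordOf-∷ w v segs last = trans (List.++-assoc (w ++ v ∷ []) _ last) (List.++-assoc w (v ∷ []) _)

concatMap-[] : ∀ {X Y : Set} (xs : List X) → concatMap (λ _ → []) xs ≡ [] {A = Y}
concatMap-[] [] = refl
concatMap-[] (_ ∷ xs) = concatMap-[] xs

module _ (inV0 : Letter → Bool) where
  open PostLie inV0

  V₀Word : Word → Set
  V₀Word = All (λ a → T (inV0 a))

  der-cong : ∀ t {p q} → p ≈ q → der t p ≈ der t q
  der-cong t = linExt-congʳ (derWord t)

  der-⊕ : ∀ t p q → der t (p ⊕ q) ≈ der t p ⊕ der t q
  der-⊕ t p q = ≡⇒≈ (List.concatMap-++ _ p q)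

  der-neg : ∀ t p → der t (neg p) ≈ neg (der t p)
  der-neg t p = mk λ f → trans (pair-linExt f (derWord t) (neg p))
    (trans (pair-neg (λ u → pair f (derWord t u)) p)
    (sym (trans (pair-neg f (der t p)) (cong -_ (pair-linExt f (derWord t) p)))))

  derWord-++ : ∀ t u w → derWord t (u ++ w) ≈ (derWord t u · word w) ⊕ (word u · derWord t w)
  derWord-++ t [] w = ≈-sym (·-identityˡ (derWord t w))
  derWord-++ t (b ∷ u) w = begin
      (D · word (u ++ w)) ⊕ (letter b · derWord t (u ++ w))
    ≈⟨ ⊕-cong (·-congʳ D (≈-sym (word-· u w))) (·-congʳ (letter b) (derWord-++ t u w)) ⟩
      (D · (word u · word w)) ⊕ (letter b · ((derWord t u · word w) ⊕ (word u · derWord t w)))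
    ≈⟨ ⊕-cong (≈-sym (·-assoc D (word u) (word w))) (·-distribˡ (letter b) (derWord t u · word w) (word u · derWord t w)) ⟩
      ((D · word u) · word w) ⊕ ((letter b · (derWord t u · word w)) ⊕ (letter b · (word u · derWord t w)))
    ≈⟨ ⊕-cong (≈-refl {(D · word u) · word w})
              (⊕-cong (≈-sym (·-assoc (letter b) (derWord t u) (word w))) (≈-sym (·-assoc (letter b) (word u) (derWord t w)))) ⟩
      ((D · word u) · word w) ⊕ (((letter b · derWord t u) · word w) ⊕ ((letter b · word u) · derWord t w))
    ≈⟨ ≈-sym (⊕-assoc ((D · word u) · word w) ((letter b · derWord t u) · word w) ((letter b · word u) · derWord t w)) ⟩
      (((D · word u) · word w) ⊕ ((letter b · derWord t u) · word w)) ⊕ ((letter b · word u) · derWord t w)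
    ≈⟨ ⊕-cong (≈-sym (·-distribʳ (D · word u) (letter b · derWord t u) (word w)))
              (·-congˡ (derWord t w) (word-· (b ∷ []) u)) ⟩
      (((D · word u) ⊕ (letter b · derWord t u)) · word w) ⊕ (word (b ∷ u) · derWord t w)
    ∎
    where
    open ≈-Reasoning
    D = derLetter t b

  der-· : ∀ t p q → der t (p · q) ≈ (der t p · q) ⊕ (p · der t q)
  der-· t p q = mk λ f → begin
      pair f (der t (p · q))
    ≡⟨ trans (pair-linExt f d (p · q)) (pair-· (λ a → pair f (d a)) p q) ⟩
      pair (λ u → pair (λ w → pair f (d (u ++ w))) q) p
    ≡⟨ pair-cong p (λ u → pair-cong q (λ w → leibniz f u w)) ⟩
      pair (λ u → pair (λ w → pair (λ a → f (a ++ w)) (d u) + pair (λ b → f (u ++ b)) (d w)) q) p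
    ≡⟨ trans (pair-cong p (λ u → pair-+ _ _ q)) (pair-+ _ _ p) ⟩
      pair (λ u → pair (λ w → pair (λ a → f (a ++ w)) (d u)) q) p
        + pair (λ u → pair (λ w → pair (λ b → f (u ++ b)) (d w)) q) p
    ≡⟨ sym (cong₂ _+_
         (trans (pair-· f (der t p) q) (trans (pair-linExt (λ a → pair (λ w → f (a ++ w)) q) d p)
                (pair-cong p (λ u → pair-swap (λ a w → f (a ++ w)) (d u) q))))
         (trans (pair-· f p (der t q)) (pair-cong p (λ u → pair-linExt (λ b → f (u ++ b)) d q)))) ⟩
      pair f (der t p · q) + pair f (p · der t q)
    ≡⟨ sym (pair-++ f (der t p · q) (p · der t q)) ⟩
      pair f ((der t p · q) ⊕ (p · der t q))
    ∎
    where
    open ≡.≡-Reasoning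
    d = derWord t
    leibniz : ∀ f u w → pair f (d (u ++ w)) ≡ pair (λ a → f (a ++ w)) (d u) + pair (λ b → f (u ++ b)) (d w)
    leibniz f u w = trans (run (derWord-++ t u w) f) (trans (pair-++ f (d u · word w) (word u · d w))
      (cong₂ _+_ (trans (pair-· f (d u) (word w)) (pair-cong (d u) (λ a → pair-word (λ b → f (a ++ b)) w)))
                 (trans (pair-· f (word u) (d w)) (pair-word (λ a → pair (λ b → f (a ++ b)) (d w)) u))))

  der-⟦⟧ : ∀ t m T → der t ⟦ m , T ⟧ ≈ ⟦ der t m , T ⟧ ⊕ ⟦ m , der t T ⟧
  der-⟦⟧ t m T = begin
      der t ((m · T) ⊖ (T · m))
    ≈⟨ der-⊕ t (m · T) (neg (T · m)) ⟩
      der t (m · T) ⊕ der t (neg (T · m))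
    ≈⟨ ⊕-cong (der-· t m T) (≈-trans (der-neg t (T · m)) (neg-cong (der-· t T m))) ⟩
      ((der t m · T) ⊕ (m · der t T)) ⊕ neg ((der t T · m) ⊕ (T · der t m))
    ≈⟨ ⊕-cong ≈-refl (≈-trans (neg-⊕ (der t T · m) (T · der t m)) (⊕-comm (neg (der t T · m)) (neg (T · der t m)))) ⟩
      ((der t m · T) ⊕ (m · der t T)) ⊕ (neg (T · der t m) ⊕ neg (der t T · m))
    ≈⟨ ⊕-interchange (der t m · T) (m · der t T) (neg (T · der t m)) (neg (der t T · m)) ⟩
      ⟦ der t m , T ⟧ ⊕ ⟦ m , der t T ⟧
    ∎
    where open ≈-Reasoning

  der-letter : ∀ t y → der t (letter y) ≈ derLetter t y
  der-letter t y = ≈-trans (linExt-word (derWord t) (y ∷ []))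
    (≈-trans (⊕-identityʳ (derLetter t y · word [])) (·-identityʳ (derLetter t y)))

  derLetter-∈V₀ : ∀ t {y} → T (inV0 y) → derLetter t y ≡ []
  derLetter-∈V₀ t y∈V₀ rewrite Equivalence.to T-≡ y∈V₀ = refl

  derLetter-∉V₀ : ∀ t {y} → T (not (inV0 y)) → derLetter t y ≡ ⟦ letter y , t ⟧
  derLetter-∉V₀ t y∉V₀ rewrite Equivalence.to T-not-≡ y∉V₀ = refl

  der-nestedBracket : ∀ {n} t (Ts : Vec Poly n) m →
    der t (nestedBracket Ts m) ≈ nestedBracket Ts (der t m) ⊕ concatMap (λ Ts′ → nestedBracket Ts′ m) (replaceEach (der t) Ts)
  der-nestedBracket t [] m = ≈-sym (⊕-identityʳ (der t m))
  der-nestedBracket t (T ∷ Ts) m = begin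
      der t (nestedBracket Ts ⟦ m , T ⟧)
    ≈⟨ der-nestedBracket t Ts ⟦ m , T ⟧ ⟩
      nestedBracket Ts (der t ⟦ m , T ⟧) ⊕ concatMap (λ Ts′ → nestedBracket Ts′ ⟦ m , T ⟧) (replaceEach (der t) Ts)
    ≈⟨ ⊕-cong (≈-trans (nestedBracket-cong Ts (der-⟦⟧ t m T)) (nestedBracket-⊕ Ts ⟦ der t m , T ⟧ ⟦ m , der t T ⟧))
              (≈-sym (concatMap-map (λ Ts′ → nestedBracket Ts′ m) (T ∷_) (replaceEach (der t) Ts))) ⟩
      (nestedBracket (T ∷ Ts) (der t m) ⊕ nestedBracket (der t T ∷ Ts) m)
        ⊕ concatMap (λ Ts′ → nestedBracket Ts′ m) (map (T ∷_) (replaceEach (der t) Ts))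
    ≈⟨ ⊕-assoc (nestedBracket (T ∷ Ts) (der t m)) (nestedBracket (der t T ∷ Ts) m) _ ⟩
      nestedBracket (T ∷ Ts) (der t m) ⊕ concatMap (λ Ts′ → nestedBracket Ts′ m) (replaceEach (der t) (T ∷ Ts))
    ∎
    where open ≈-Reasoning

  -- The correction term of x A ▷ y cancels the terms of x ▷ (A ▷ y) in which the
  -- derivation hits a factor of the bracket rather than its innermost letter.
  actLie-∉V₀ : ∀ n (Ts : Vec Poly n) y → T (not (inV0 y)) → actLie n Ts y ≈ nestedBracket Ts (letter y)
  actLie-∉V₀ zero [] y y∉V₀ = ≈-refl
  actLie-∉V₀ (suc n) (t ∷ Ts) y y∉V₀ = begin
      der t (actLie n Ts y) ⊖ concatMap (λ Ts′ → actLie n Ts′ y) (replaceEach (der t) Ts)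
    ≈⟨ ⊖-cong (der-cong t (actLie-∉V₀ n Ts y y∉V₀))
              (concatMap-cong (replaceEach (der t) Ts) (λ Ts′ → actLie-∉V₀ n Ts′ y y∉V₀)) ⟩
      der t (nestedBracket Ts (letter y)) ⊖ corrections
    ≈⟨ ⊖-cong (der-nestedBracket t Ts (letter y)) ≈-refl ⟩
      (nestedBracket Ts (der t (letter y)) ⊕ corrections) ⊖ corrections
    ≈⟨ ⊕-⊖-cancel (nestedBracket Ts (der t (letter y))) corrections ⟩
      nestedBracket Ts (der t (letter y))
    ≈⟨ nestedBracket-cong Ts (≈-trans (der-letter t y) (≡⇒≈ (derLetter-∉V₀ t y∉V₀))) ⟩
      nestedBracket (t ∷ Ts) (letter y)
    ∎
    where
    open ≈-Reasoning
    corrections = concatMap (λ Ts′ → nestedBracket Ts′ (letter y)) (replaceEach (der t) Ts)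

  actLie-∈V₀ : ∀ n (Ts : Vec Poly (suc n)) y → T (inV0 y) → actLie (suc n) Ts y ≈ []
  actLie-∈V₀ zero (t ∷ []) y y∈V₀ =
    ≈-trans (⊕-identityʳ (der t (letter y))) (≈-trans (der-letter t y) (≡⇒≈ (derLetter-∈V₀ t y∈V₀)))
  actLie-∈V₀ (suc n) (t ∷ Ts) y y∈V₀ = ≈-trans
    (⊖-cong (der-cong t (actLie-∈V₀ n Ts y y∈V₀))
            (concatMap-cong (replaceEach (der t) Ts) (λ Ts′ → actLie-∈V₀ n Ts′ y y∈V₀)))
    (≡⇒≈ (cong neg (concatMap-[] (replaceEach (der t) Ts))))

  act-∷ : ∀ a b C → act a (b ∷ C) ≡ concatMap (λ lr → actLetter (proj₁ lr) b · act (proj₂ lr) C) (deshuffle a)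
  act-∷ [] b C = refl
  act-∷ (_ ∷ _) b C = refl

  act-[] : ∀ a → act a [] ≡ ε[ a ] one
  act-[] [] = refl
  act-[] (_ ∷ _) = refl

  act-∈V₀ : ∀ {b} → T (inV0 b) → ∀ a C → act a (b ∷ C) ≈ letter b · act a C
  act-∈V₀ {b} b∈V₀ a C = ≈-trans (≡⇒≈ (act-∷ a b C))
    (≈-trans (concatMap-cong (deshuffle a) only-empty-acts) (counitˡ (λ r → letter b · act r C) a))
    where
    only-empty-acts : ∀ lr → actLetter (proj₁ lr) b · act (proj₂ lr) C ≈ ε[ proj₁ lr ] (letter b · act (proj₂ lr) C)
    only-empty-acts ([] , r) = ≈-refl
    only-empty-acts (x ∷ l , r) = ·-congˡ (act r C) (actLie-∈V₀ (length l) (Vec.map letter (fromList (x ∷ l))) b b∈V₀)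

  act-V₀-prefix : ∀ {w} → V₀Word w → ∀ a C → act a (w ++ C) ≈ word w · act a C
  act-V₀-prefix [] a C = ≈-sym (·-identityˡ (act a C))
  act-V₀-prefix {b ∷ w} (b∈V₀ ∷ w∈V₀*) a C = begin
      act a (b ∷ (w ++ C))
    ≈⟨ act-∈V₀ b∈V₀ a (w ++ C) ⟩
      letter b · act a (w ++ C)
    ≈⟨ ·-congʳ (letter b) (act-V₀-prefix w∈V₀* a C) ⟩
      letter b · (word w · act a C)
    ≈⟨ ≈-sym (·-assoc (letter b) (word w) (act a C)) ⟩
      (letter b · word w) · act a C
    ≈⟨ ·-congˡ (act a C) (word-· (b ∷ []) w) ⟩
      word (b ∷ w) · act a C
    ∎
    where open ≈-Reasoning

  glWord : Word → Word → Poly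
  glWord a b = concatMap (λ lr → word (proj₁ lr) · act (proj₂ lr) b) (deshuffle a)

  act-∉V₀ : ∀ {v} → T (not (inV0 v)) → ∀ a C →
    act a (v ∷ C) ≈ concatMap (λ lr → (S (proj₁ lr) · letter v) · glWord (proj₂ lr) C) (deshuffle a)
  act-∉V₀ {v} v∉V₀ a C = begin
      act a (v ∷ C)
    ≡⟨ act-∷ a v C ⟩
      concatMap (λ lr → actLetter (proj₁ lr) v · act (proj₂ lr) C) (deshuffle a)
    ≈⟨ concatMap-cong (deshuffle a) (λ lr → ·-congˡ (act (proj₂ lr) C) (actLetter-∉V₀ (proj₁ lr))) ⟩
      concatMap (λ lr → concatMap (conjugate (letter v)) (deshuffle (proj₁ lr)) · act (proj₂ lr) C) (deshuffle a)
    ≈⟨ concatMap-cong (deshuffle a) (λ lr → concatMap-·ʳ (conjugate (letter v)) (deshuffle (proj₁ lr)) (act (proj₂ lr) C)) ⟩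
      concatMap (λ lr → concatMap (λ lr′ → conjugate (letter v) lr′ · act (proj₂ lr) C) (deshuffle (proj₁ lr))) (deshuffle a)
    ≈⟨ deshuffle-coassoc (λ p q r → conjugate (letter v) (p , q) · act r C) a ⟩
      concatMap (λ lr → concatMap (λ lr′ → conjugate (letter v) (proj₁ lr , proj₁ lr′) · act (proj₂ lr′) C)
                                  (deshuffle (proj₂ lr))) (deshuffle a)
    ≈⟨ concatMap-cong (deshuffle a) (λ lr → factor-out (proj₁ lr) (proj₂ lr)) ⟩
      concatMap (λ lr → (S (proj₁ lr) · letter v) · glWord (proj₂ lr) C) (deshuffle a)
    ∎
    where
    open ≈-Reasoning
    actLetter-∉V₀ : ∀ l → actLetter l v ≈ concatMap (conjugate (letter v)) (deshuffle l)
    actLetter-∉V₀ l = ≈-trans (actLie-∉V₀ (length l) (Vec.map letter (fromList l)) v v∉V₀)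
                              (nestedBracket-letters l (letter v))
    factor-out : ∀ p m → concatMap (λ lr′ → conjugate (letter v) (p , proj₁ lr′) · act (proj₂ lr′) C) (deshuffle m)
                         ≈ (S p · letter v) · glWord m C
    factor-out p m = ≈-trans
      (concatMap-cong (deshuffle m) (λ lr′ → ·-assoc (S p · letter v) (word (proj₁ lr′)) (act (proj₂ lr′) C)))
      (≈-sym (concatMap-·ˡ (S p · letter v) _ (deshuffle m)))

  glWord-V₀ : ∀ {last} → V₀Word last → ∀ a → glWord a last ≈ word (a ++ last)
  glWord-V₀ {last} last∈V₀* a = ≈-trans (concatMap-cong (deshuffle a) term) (counitʳ (λ l → word (l ++ last)) a)
    where
    act-last : ∀ r → act r last ≈ word last · ε[ r ] one
    act-last r = ≈-trans (≡⇒≈ (cong (act r) (sym (List.++-identityʳ last))))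
      (≈-trans (act-V₀-prefix last∈V₀* r []) (≡⇒≈ (cong (word last ·_) (act-[] r))))
    term : ∀ lr → word (proj₁ lr) · act (proj₂ lr) last ≈ ε[ proj₂ lr ] word (proj₁ lr ++ last)
    term (l , []) = ≈-trans (·-congʳ (word l) (≈-trans (act-last []) (·-identityʳ (word last)))) (word-· l last)
    term (l , r@(_ ∷ _)) = ≈-trans (·-congʳ (word l) (≈-trans (act-last r) (·-zeroʳ (word last)))) (·-zeroʳ (word l))

  glWord-∉V₀ : ∀ {w v} → V₀Word w → T (not (inV0 v)) → ∀ R a →
    glWord a (w ++ v ∷ R) ≈ spliceAt w v (λ m → glWord m R) a
  glWord-∉V₀ {w} {v} w∈V₀* v∉V₀ R a = concatMap-cong (deshuffle a) λ lr → begin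
      word (proj₁ lr) · act (proj₂ lr) (w ++ v ∷ R)
    ≈⟨ ·-congʳ (word (proj₁ lr)) (act-V₀-prefix w∈V₀* (proj₂ lr) (v ∷ R)) ⟩
      word (proj₁ lr) · (word w · act (proj₂ lr) (v ∷ R))
    ≈⟨ ≈-sym (·-assoc (word (proj₁ lr)) (word w) (act (proj₂ lr) (v ∷ R))) ⟩
      (word (proj₁ lr) · word w) · act (proj₂ lr) (v ∷ R)
    ≈⟨ ·-cong (word-· (proj₁ lr) w) (act-∉V₀ v∉V₀ (proj₂ lr) R) ⟩
      word (proj₁ lr ++ w) ·
        concatMap (λ lr′ → (S (proj₁ lr′) · letter v) · glWord (proj₂ lr′) R) (deshuffle (proj₂ lr))
    ∎
    where open ≈-Reasoning

  glWord-wordOf : ∀ segs last → All (λ s → V₀Word (proj₁ s) × T (not (inV0 (proj₂ s)))) segs → V₀Word last →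
    ∀ a → glWord a (wordOf segs last) ≈ concatMap (assemble segs last) (coprodN (double (length segs)) a)
  glWord-wordOf [] last [] last∈V₀* a = ≈-trans (glWord-V₀ last∈V₀* a) (≈-sym (⊕-identityʳ (word (a ++ last))))
  glWord-wordOf ((w , v) ∷ segs) last ((w∈V₀* , v∉V₀) ∷ segs-ok) last∈V₀* a = begin
      glWord a (wordOf ((w , v) ∷ segs) last)
    ≡⟨ cong (glWord a) (wordOf-∷ w v segs last) ⟩
      glWord a (w ++ v ∷ wordOf segs last)
    ≈⟨ glWord-∉V₀ w∈V₀* v∉V₀ (wordOf segs last) a ⟩
      spliceAt w v (λ m → glWord m (wordOf segs last)) a
    ≈⟨ spliceAt-cong w v (glWord-wordOf segs last segs-ok last∈V₀*) a ⟩
      spliceAt w v (λ m → concatMap (assemble segs last) (coprodN (double (length segs)) m)) a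
    ≈⟨ ≈-sym (assemble-coprodN-∷ w v segs last a) ⟩
      concatMap (assemble ((w , v) ∷ segs) last) (coprodN (double (length ((w , v) ∷ segs))) a)
    ∎
    where open ≈-Reasoning

proposition3p12 : (inV0 : Letter → Bool) (A : Poly)
    (segs : List (Word × Letter)) (last : Word)
    → All (λ s → All (λ a → T (inV0 a)) (proj₁ s) × T (not (inV0 (proj₂ s)))) segs
    → All (λ a → T (inV0 a)) last
    → PostLie.GL inV0 A (word (wordOf segs last)) ≈P rhs A segs last
proposition3p12 inV0 A segs last segs-ok last∈V₀* = ≈⇒≈P (linExt-cong A λ a →
  ≈-trans (linExt-word (glWord inV0 a) (wordOf segs last)) (glWord-wordOf inV0 segs last segs-ok last∈V₀* a))
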